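{- For each $k\in\mathbb{N}$, the sequence (indexed by $m\ge 1$) of sequences $$\big((S_1(m)\bmod k,\ S_2(m)\bmod k,\ S_3(m)\bmod k,\ \dots)\big)_{m\ge 1}$$ is periodic. If $k=q_1^{a_1}q_2^{a_2}\cdots q_r^{a_r}$ where the $q_i$ are distinct primes, then its (least) period is $q_1^{a_1+1}q_2^{a_2+1}\cdots q_r^{a_r+1}$.
   Context: $\mathbb{N}$ denotes the positive integers. $S_n(m)=\sum_{i=1}^m i^n$. Each term of the outer sequence is the infinite sequence $(S_n(m)\bmod k)_{n\ge 1}$; periodicity means there is $L\ge1$ with these infinite sequences equal for $m$ and $m+L$ for all $m\ge1$, and the period is the least such $L$. -}

module Defs where

open import Data.Nat using (ℕ; zero; suc; _+_; _*_; _^_; _≤_; NonZero)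
open import Data.Nat.DivMod using (_%_)
open import Data.Nat.Primality using (Prime)
open import Data.List using (List; []; _∷_; map)
open import Data.Nat.ListAction using (product)
open import Data.List.Relation.Unary.All using (All)
open import Data.List.Relation.Unary.Unique.Propositional using (Unique)
open import Data.Product using (_×_; proj₁; proj₂)
open import Relation.Binary.PropositionalEquality using (_≡_)

S : ℕ → ℕ → ℕ
S n zero    = 0
S n (suc m) = S n m + suc m ^ n

SameSeq : (k : ℕ) → .{{NonZero k}} → ℕ → ℕ → Set
SameSeq k m m' = ∀ n → 1 ≤ n → S n m % k ≡ S n m' % k

IsPeriod : (k : ℕ) → .{{NonZero k}} → ℕ → Set
IsPeriod k L = 1 ≤ L × (∀ m → 1 ≤ m → SameSeq k m (m + L))

IsLeastPeriod : (k : ℕ) → .{{NonZero k}} → ℕ → Set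
IsLeastPeriod k L = IsPeriod k L × (∀ L' → IsPeriod k L' → L ≤ L')

IsFactorisation : ℕ → List (ℕ × ℕ) → Set
IsFactorisation k fs =
  All (λ p → Prime (proj₁ p)) fs ×
  Unique (map proj₁ fs) ×
  All (λ p → 1 ≤ proj₂ p) fs ×
  product (map (λ p → proj₁ p ^ proj₂ p) fs) ≡ k

periodOf : List (ℕ × ℕ) → ℕ
periodOf fs = product (map (λ p → proj₁ p ^ suc (proj₂ p)) fs)

module Submission where

-- Let k = ∏ qᵢ^aᵢ and P = ∏ qᵢ^(aᵢ+1).  Everything rests on a criterion:
-- L ≥ 1 is a period of m ↦ (S_n(m) mod k)_{n≥1} iff k ∣ L and k ∣ S_n(L)
-- for all n ≥ 1.  It follows from S_n(m + L) ≡ S_n(m) + S_n(L) (mod k) for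
-- k ∣ L, which iterated gives S_n(d·N) ≡ d·S_n(N) (mod M) whenever M ∣ N;
-- hence q^a ∣ S_n(N) whenever q^(a+1) ∣ N (in particular k ∣ S_n(k²)).
--   Upper bound: each qᵢ^aᵢ divides P and S_n(P); the qᵢ^aᵢ are pairwise
-- coprime, so k divides both and P is a period (likewise k² always is).
--   Lower bound: for a prime q = r + 2 with q ∣ L and q^a ∣ S_n(L) for all
-- n ≥ 1, linear combinations of power sums give q^a ∣ Σᵢ i(i+1)⋯(i+r), and
-- telescoping turns q·Σᵢ i(i+1)⋯(i+r) into L(L+1)⋯(L+r+1), whose factors
-- other than L are prime to q; so q^(a+1) ∣ L.  By coprimality of the prime
-- powers, every period is a multiple of P, hence at least P.

open import Data.Nat
open import Data.Nat.Properties
open import Data.Nat.DivMod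
open import Data.Nat.Divisibility
open import Data.Nat.Coprimality using (Coprime; coprime-divisor; 1-coprimeTo)
  renaming (sym to coprime-sym)
open import Data.Nat.Primality
  using (Prime; euclidsLemma; prime⇒irreducible; prime⇒nonZero; prime⇒nonTrivial)
open import Data.Nat.ListAction using (product)
open import Data.Nat.ListAction.Properties using (∈⇒∣product; product≢0)
open import Data.Nat.Tactic.RingSolver using (solve-∀)
open import Algebra.Properties.CommutativeSemigroup +-commutativeSemigroup
  using (xy∙z≈xz∙y; xy∙z≈y∙xz)
open import Data.List using (List; []; _∷_; map)
open import Data.List.Membership.Propositional using (_∈_)
open import Data.List.Membership.Propositional.Properties using (∈-map⁺)
open import Data.List.Relation.Unary.All as All using (All; []; _∷_)
open import Data.List.Relation.Unary.All.Properties using (map⁺)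
open import Data.List.Relation.Unary.AllPairs using (_∷_)
open import Data.List.Relation.Unary.Unique.Propositional using (Unique)
open import Data.List.Relation.Unary.Any using (here; there)
open import Data.Product using (Σ; _×_; _,_; proj₁; proj₂)
open import Data.Sum using (inj₁; inj₂)
open import Function using (id; _∘′_)
open import Relation.Nullary using (¬_; contradiction)
open import Relation.Binary.PropositionalEquality

open import Defs

module Congruence (k : ℕ) .{{_ : NonZero k}} where

  infix 4 _≋_
  _≋_ : ℕ → ℕ → Set
  a ≋ b = a % k ≡ b % k

  +-cong : ∀ {a b c d} → a ≋ b → c ≋ d → a + c ≋ b + d
  +-cong {a} {b} {c} {d} a≋b c≋d = begin
    (a + c) % k          ≡⟨ %-distribˡ-+ a c k ⟩
    (a % k + c % k) % k  ≡⟨ cong₂ (λ x y → (x + y) % k) a≋b c≋d ⟩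
    (b % k + d % k) % k  ≡⟨ sym (%-distribˡ-+ b d k) ⟩
    (b + d) % k          ∎
    where open ≡-Reasoning

  *-cong : ∀ {a b c d} → a ≋ b → c ≋ d → a * c ≋ b * d
  *-cong {a} {b} {c} {d} a≋b c≋d = begin
    (a * c) % k            ≡⟨ %-distribˡ-* a c k ⟩
    (a % k * (c % k)) % k  ≡⟨ cong₂ (λ x y → (x * y) % k) a≋b c≋d ⟩
    (b % k * (d % k)) % k  ≡⟨ sym (%-distribˡ-* b d k) ⟩
    (b * d) % k            ∎
    where open ≡-Reasoning

  ^-cong : ∀ {a b} n → a ≋ b → a ^ n ≋ b ^ n
  ^-cong zero    a≋b = refl
  ^-cong (suc n) a≋b = *-cong a≋b (^-cong n a≋b)

  ∣⇒≋0 : ∀ {a} → k ∣ a → a ≋ 0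
  ∣⇒≋0 {a} k∣a = trans (n∣m⇒m%n≡0 a k k∣a) (sym (m*n%n≡0 0 k))

  ≋0⇒∣ : ∀ {a} → a ≋ 0 → k ∣ a
  ≋0⇒∣ {a} a≋0 = m%n≡0⇒n∣m a k (trans a≋0 (m*n%n≡0 0 k))

  ∣-resp-≋ : ∀ {a b} → a ≋ b → k ∣ b → k ∣ a
  ∣-resp-≋ a≋b k∣b = ≋0⇒∣ (trans a≋b (∣⇒≋0 k∣b))

  inverse : ∀ a → k ∣ a + (k ∸ a % k)
  inverse a = divides (suc (a / k)) (begin
    a + (k ∸ a % k)                    ≡⟨ cong (_+ (k ∸ a % k)) (m≡m%n+[m/n]*n a k) ⟩
    a % k + a / k * k + (k ∸ a % k)    ≡⟨ xy∙z≈y∙xz (a % k) (a / k * k) (k ∸ a % k) ⟩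
    a / k * k + (a % k + (k ∸ a % k))  ≡⟨ cong (a / k * k +_) (m+[n∸m]≡n (m%n≤n a k)) ⟩
    a / k * k + k                      ≡⟨ +-comm (a / k * k) k ⟩
    suc (a / k) * k                    ∎)
    where open ≡-Reasoning

  +-cancelˡ : ∀ {a b x y} → a ≋ b → a + x ≋ b + y → x ≋ y
  +-cancelˡ {a} {b} {x} {y} a≋b e = begin
    x % k          ≡⟨ sym (%-remove-+ˡ x (inverse a)) ⟩
    (a + c + x) % k  ≡⟨ cong (_% k) (xy∙z≈xz∙y a c x) ⟩
    (a + x + c) % k  ≡⟨ +-cong e refl ⟩
    (b + y + c) % k  ≡⟨ cong (_% k) (xy∙z≈xz∙y b y c) ⟩
    (b + c + y) % k  ≡⟨ %-remove-+ˡ y (subst (λ r → k ∣ b + (k ∸ r)) (sym a≋b) (inverse b)) ⟩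
    y % k          ∎
    where
      open ≡-Reasoning
      c : ℕ
      c = k ∸ a % k

  +-cancelʳ : ∀ {a b x y} → a ≋ b → x + a ≋ y + b → x ≋ y
  +-cancelʳ {a} {b} {x} {y} a≋b e =
    +-cancelˡ a≋b (subst₂ _≋_ (+-comm x a) (+-comm y b) e)

  -- If k ∣ P, the sum over m + P terms splits as the sum over m terms
  -- plus the sum over the P shifted terms, each congruent to its unshifted one.
  S-shift : ∀ {P} → k ∣ P → ∀ n m → S n (m + P) ≋ S n m + S n P
  S-shift k∣P n zero    = refl
  S-shift {P} k∣P n (suc m) = begin
    (S n (m + P) + suc (m + P) ^ n) % k
      ≡⟨ +-cong (S-shift k∣P n m) (^-cong n (%-remove-+ʳ (suc m) k∣P)) ⟩
    (S n m + S n P + suc m ^ n) % k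
      ≡⟨ cong (_% k) (xy∙z≈xz∙y (S n m) (S n P) (suc m ^ n)) ⟩
    (S n m + suc m ^ n + S n P) % k ∎
    where open ≡-Reasoning

  S-blocks : ∀ {N} → k ∣ N → ∀ n d → S n (d * N) ≋ d * S n N
  S-blocks k∣N n zero    = refl
  S-blocks {N} k∣N n (suc d) = begin
    S n (N + d * N) % k        ≡⟨ cong (λ t → S n t % k) (+-comm N (d * N)) ⟩
    S n (d * N + N) % k        ≡⟨ S-shift k∣N n (d * N) ⟩
    (S n (d * N) + S n N) % k  ≡⟨ +-cong (S-blocks k∣N n d) refl ⟩
    (d * S n N + S n N) % k    ≡⟨ cong (_% k) (+-comm (d * S n N) (S n N)) ⟩
    (suc d * S n N) % k        ∎
    where open ≡-Reasoning

module Criterion (k : ℕ) .{{_ : NonZero k}} where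
  open Congruence k

  period⇒conditions : ∀ {L} → IsPeriod k L → k ∣ L × (∀ n → 1 ≤ n → k ∣ S n L)
  period⇒conditions {L} (_ , same) = k∣L , k∣S
    where
      -- comparing m = 1 and m = 2 for n = 1 isolates the last terms 2 and 2 + L
      2≋2+L : 2 ≋ 2 + L
      2≋2+L = trans (+-cancelˡ {S 1 1} {S 1 (1 + L)} {2} {(2 + L) * 1}
                                (same 1 (s≤s z≤n) 1 (s≤s z≤n)) (same 2 (s≤s z≤n) 1 (s≤s z≤n)))
                    (cong (_% k) (*-identityʳ (2 + L)))

      k∣L : k ∣ L
      k∣L = ≋0⇒∣ (sym (+-cancelˡ {2} {2} {0} {L} refl 2≋2+L))

      -- for m = 1: S n (1 + L) = S n L + (1 + L)^n and (1 + L)^n ≡ 1 = S n 1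
      k∣S : ∀ n → 1 ≤ n → k ∣ S n L
      k∣S n n≥1 = ≋0⇒∣ (+-cancelʳ {(1 + L) ^ n} {1 ^ n} {S n L} {0}
                          (^-cong n (%-remove-+ʳ 1 k∣L)) (sym (same 1 (s≤s z≤n) n n≥1)))

  conditions⇒period : ∀ {L} → 1 ≤ L → k ∣ L → (∀ n → 1 ≤ n → k ∣ S n L) → IsPeriod k L
  conditions⇒period {L} L≥1 k∣L k∣S = L≥1 , λ m _ n n≥1 →
    sym (trans (S-shift k∣L n m) (%-remove-+ʳ (S n m) (k∣S n n≥1)))

power-∣-sum : ∀ q .{{_ : NonZero q}} a n → q ^ a ∣ S n (q ^ suc a)
power-∣-sum q zero    n = 1∣ _
power-∣-sum q (suc a) n =
  ∣-resp-≋ (S-blocks ∣-refl n q) (*-monoʳ-∣ q (power-∣-sum q a n))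
  where
    instance
      q^a+1≢0 : NonZero (q ^ suc a)
      q^a+1≢0 = m^n≢0 q (suc a)
    open Congruence (q ^ suc a)

∣-sum-of-multiple : ∀ {q} .{{_ : NonZero q}} a {N} n → q ^ suc a ∣ N → q ^ a ∣ S n N
∣-sum-of-multiple {q} a n (divides c refl) =
  ∣-resp-≋ (S-blocks (n∣m*n q) n c) (∣n⇒∣m*n c (power-∣-sum q a n))
  where
    instance
      q^a≢0 : NonZero (q ^ a)
      q^a≢0 = m^n≢0 q a
    open Congruence (q ^ a)

prime>1 : ∀ {p} → Prime p → 1 < p
prime>1 {p} pp = nonTrivial⇒n>1 p {{prime⇒nonTrivial pp}}

prime∤⇒coprime : ∀ {p n} → Prime p → ¬ p ∣ n → Coprime p n
prime∤⇒coprime pp p∤n (i∣p , i∣n) with prime⇒irreducible pp i∣p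
... | inj₁ i≡1 = i≡1
... | inj₂ refl = contradiction i∣n p∤n

distinct-primes : ∀ {p q} → Prime p → Prime q → p ≢ q → ¬ p ∣ q
distinct-primes pp pq p≢q p∣q with prime⇒irreducible pq p∣q
... | inj₁ p≡1 = <⇒≢ (prime>1 pp) (sym p≡1)
... | inj₂ p≡q = p≢q p≡q

coprime-*ʳ : ∀ {m n o} → Coprime m n → Coprime m o → Coprime m (n * o)
coprime-*ʳ m⊥n m⊥o (i∣m , i∣no) =
  m⊥o (i∣m , coprime-divisor (λ (j∣i , j∣n) → m⊥n (∣-trans j∣i i∣m , j∣n)) i∣no)

coprime-^ʳ : ∀ {m n} → Coprime m n → ∀ b → Coprime m (n ^ b)
coprime-^ʳ {m} m⊥n zero    = coprime-sym (1-coprimeTo m)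
coprime-^ʳ     m⊥n (suc b) = coprime-*ʳ m⊥n (coprime-^ʳ m⊥n b)

coprime-^ˡ : ∀ {m n} → Coprime m n → ∀ b → Coprime (m ^ b) n
coprime-^ˡ m⊥n b = coprime-sym (coprime-^ʳ (coprime-sym m⊥n) b)

coprime⇒*∣ : ∀ {m n o} → Coprime m n → m ∣ o → n ∣ o → m * n ∣ o
coprime⇒*∣ {m} {n} m⊥n (divides a refl) n∣am =
  subst (m * n ∣_) (*-comm m a)
        (*-monoʳ-∣ m (coprime-divisor (coprime-sym m⊥n) (subst (n ∣_) (*-comm a m) n∣am)))

sumTo : (ℕ → ℕ) → ℕ → ℕ
sumTo f zero    = 0
sumTo f (suc m) = sumTo f m + f (suc m)

S≡sumTo : ∀ n m → S n m ≡ sumTo (_^ n) m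
S≡sumTo n zero    = refl
S≡sumTo n (suc m) = cong (_+ suc m ^ n) (S≡sumTo n m)

sumTo-cong : ∀ {f g} → (∀ i → f i ≡ g i) → ∀ m → sumTo f m ≡ sumTo g m
sumTo-cong f≡g zero    = refl
sumTo-cong f≡g (suc m) = cong₂ _+_ (sumTo-cong f≡g m) (f≡g (suc m))

sumTo-linear : ∀ f c g m → sumTo (λ i → f i + c * g i) m ≡ sumTo f m + c * sumTo g m
sumTo-linear f c g zero    = sym (*-zeroʳ c)
sumTo-linear f c g (suc m) rewrite sumTo-linear f c g m =
  shuffle (sumTo f m) c (sumTo g m) (f (suc m)) (g (suc m))
  where
    shuffle : ∀ a c b x y → a + c * b + (x + c * y) ≡ a + x + c * (b + y)
    shuffle = solve-∀

rising : ℕ → ℕ → ℕ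
rising zero    i = 1
rising (suc r) i = rising r i * (i + suc r)

-- If d divides all power sums up to L, it divides all the weighted sums
-- Σᵢ rising r i · iⁿ (n ≥ 1), since rising (r+1) i · iⁿ is a combination
-- of rising r i · iⁿ⁺¹ and rising r i · iⁿ.
weighted-sums-∣ : ∀ {d L} → (∀ n → 1 ≤ n → d ∣ S n L) →
                  ∀ r n → 1 ≤ n → d ∣ sumTo (λ i → rising r i * i ^ n) L
weighted-sums-∣ {d} {L} H zero n n≥1 =
  subst (d ∣_) (trans (S≡sumTo n L) (sumTo-cong (λ i → sym (*-identityˡ (i ^ n))) L)) (H n n≥1)
weighted-sums-∣ {d} {L} H (suc r) n n≥1 =
  subst (d ∣_) (sym expand)
        (∣m∣n⇒∣m+n (weighted-sums-∣ {L = L} H r (suc n) (s≤s z≤n))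
                   (∣n⇒∣m*n (suc r) (weighted-sums-∣ {L = L} H r n n≥1)))
  where
    step : ∀ R i p r → R * (i + suc r) * p ≡ R * (i * p) + suc r * (R * p)
    step = solve-∀
    expand : sumTo (λ i → rising (suc r) i * i ^ n) L
           ≡ sumTo (λ i → rising r i * i ^ suc n) L + suc r * sumTo (λ i → rising r i * i ^ n) L
    expand = trans (sumTo-cong (λ i → step (rising r i) i (i ^ n) r) L)
                   (sumTo-linear (λ i → rising r i * i ^ suc n) (suc r) (λ i → rising r i * i ^ n) L)

rising-shift : ∀ r L → rising (suc r) L ≡ suc L * rising r (suc L)
rising-shift zero    L = trans (*-identityˡ (L + 1)) (trans (+-comm L 1) (sym (*-identityʳ (suc L))))
rising-shift (suc r) L = begin
  rising (suc r) L * (L + suc (suc r))           ≡⟨ cong (_* (L + suc (suc r))) (rising-shift r L) ⟩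
  suc L * rising r (suc L) * (L + suc (suc r))   ≡⟨ regroup (suc L) (rising r (suc L)) L r ⟩
  suc L * (rising r (suc L) * (suc L + suc r))   ∎
  where
    open ≡-Reasoning
    regroup : ∀ a R L r → a * R * (L + suc (suc r)) ≡ a * (R * (suc L + suc r))
    regroup = solve-∀

rising-telescope : ∀ r L → suc (suc r) * sumTo (λ i → rising r i * i) L ≡ L * rising (suc r) L
rising-telescope r zero    = *-zeroʳ (suc (suc r))
rising-telescope r (suc L) = begin
  c * (T + R * suc L)              ≡⟨ *-distribˡ-+ c T (R * suc L) ⟩
  c * T + c * (R * suc L)          ≡⟨ cong (_+ c * (R * suc L)) (rising-telescope r L) ⟩
  L * rising (suc r) L + c * (R * suc L)  ≡⟨ cong (λ t → L * t + c * (R * suc L)) (rising-shift r L) ⟩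
  L * (suc L * R) + c * (R * suc L)   ≡⟨ collect L R r ⟩
  suc L * (R * (suc L + suc r))    ∎
  where
    open ≡-Reasoning
    c T R : ℕ
    c = suc (suc r)
    T = sumTo (λ i → rising r i * i) L
    R = rising r (suc L)
    collect : ∀ L R r → L * (suc L * R) + suc (suc r) * (R * suc L) ≡ suc L * (R * (suc L + suc r))
    collect = solve-∀

rising-product-∣ : ∀ {d L} → (∀ n → 1 ≤ n → d ∣ S n L) → ∀ r → suc (suc r) * d ∣ L * rising (suc r) L
rising-product-∣ {d} {L} H r =
  subst (suc (suc r) * d ∣_) (rising-telescope r L)
        (*-monoʳ-∣ (suc (suc r))
          (subst (d ∣_) (sumTo-cong (λ i → cong (rising r i *_) (*-identityʳ i)) L)
                 (weighted-sums-∣ {L = L} H r 1 ≤-refl)))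

prime-∤-rising : ∀ {q L} → Prime q → q ∣ L → ∀ r → r < q → ¬ q ∣ rising r L
prime-∤-rising pq q∣L zero    r<q q∣1 = <⇒≢ (prime>1 pq) (sym (∣1⇒≡1 q∣1))
prime-∤-rising {q} {L} pq q∣L (suc r) r<q q∣R with euclidsLemma (rising r L) (L + suc r) pq q∣R
... | inj₁ q∣rising = prime-∤-rising pq q∣L r (<-trans (n<1+n r) r<q) q∣rising
... | inj₂ q∣L+r    = <⇒≱ r<q (∣⇒≤ (∣m+n∣m⇒∣n q∣L+r q∣L))

prime-power-bound : ∀ {q L} a → Prime q → q ∣ L → (∀ n → 1 ≤ n → q ^ a ∣ S n L) → q ^ suc a ∣ L
prime-power-bound {q} {L} a pq q∣L H with prime>1 pq
... | s≤s (s≤s {n = r} _) =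
  coprime-divisor q^a+1⊥rising
    (subst (q ^ suc a ∣_) (*-comm L (rising (suc r) L)) (rising-product-∣ {L = L} H r))
  where
    q^a+1⊥rising : Coprime (q ^ suc a) (rising (suc r) L)
    q^a+1⊥rising = coprime-^ˡ (prime∤⇒coprime pq (prime-∤-rising pq q∣L (suc r) ≤-refl)) (suc a)

AllPrime : List (ℕ × ℕ) → Set
AllPrime fs = All (λ p → Prime (proj₁ p)) fs

∏powers : (ℕ → ℕ) → List (ℕ × ℕ) → ℕ
∏powers e fs = product (map (λ p → proj₁ p ^ e (proj₂ p)) fs)

∏powers≢0 : ∀ e {fs} → AllPrime fs → NonZero (∏powers e fs)
∏powers≢0 e ps = product≢0 (map⁺ (All.map (λ {p} pq → m^n≢0 (proj₁ p) (e (proj₂ p)) {{prime⇒nonZero pq}}) ps))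

∈⇒power∣∏ : ∀ e {fs q a} → (q , a) ∈ fs → q ^ e a ∣ ∏powers e fs
∈⇒power∣∏ e q∈fs = ∈⇒∣product (∈-map⁺ (λ p → proj₁ p ^ e (proj₂ p)) q∈fs)

coprime-∏ : ∀ e {q} fs → Prime q → AllPrime fs → All (q ≢_) (map proj₁ fs) → Coprime q (∏powers e fs)
coprime-∏ e []               pq _          _            = coprime-sym (1-coprimeTo _)
coprime-∏ e ((q' , a) ∷ fs)  pq (pq' ∷ ps) (q≢q' ∷ q∉) =
  coprime-*ʳ (coprime-^ʳ (prime∤⇒coprime pq (distinct-primes pq pq' q≢q')) (e a)) (coprime-∏ e fs pq ps q∉)

∏powers-∣ : ∀ e {L} fs → AllPrime fs → Unique (map proj₁ fs) →
            (∀ {q a} → (q , a) ∈ fs → q ^ e a ∣ L) → ∏powers e fs ∣ L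
∏powers-∣ e []              _          _          _ = 1∣ _
∏powers-∣ e ((q , a) ∷ fs) (pq ∷ ps) (q∉ ∷ u) H =
  coprime⇒*∣ (coprime-^ˡ (coprime-∏ e fs pq ps q∉) (e a)) (H (here refl)) (∏powers-∣ e fs ps u (H ∘′ there))

square-isPeriod : ∀ k .{{_ : NonZero k}} → IsPeriod k (k ^ 2)
square-isPeriod k = conditions⇒period (>-nonZero⁻¹ (k ^ 2) {{m^n≢0 k 2}}) (m∣m*n _)
                      (λ n _ → ∣-trans (m∣m*n 1) (power-∣-sum k 1 n))
  where open Criterion k

-- ∏ q^(a+1) is a period: each q^a divides it and its power sums.
periodOf-isPeriod : ∀ k .{{_ : NonZero k}} fs → IsFactorisation k fs → IsPeriod k (periodOf fs)
periodOf-isPeriod k fs (ps , u , _ , ∏≡k) =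
  conditions⇒period (>-nonZero⁻¹ _ {{∏powers≢0 suc ps}}) k∣P k∣S
  where
    open Criterion k
    q^a+1∣P : ∀ {q a} → (q , a) ∈ fs → q ^ suc a ∣ periodOf fs
    q^a+1∣P = ∈⇒power∣∏ suc
    k∣P : k ∣ periodOf fs
    k∣P = subst (_∣ periodOf fs) ∏≡k (∏powers-∣ id fs ps u (λ {q} q∈ → ∣-trans (n∣m*n q) (q^a+1∣P q∈)))
    k∣S : ∀ n → 1 ≤ n → k ∣ S n (periodOf fs)
    k∣S n _ = subst (_∣ S n (periodOf fs)) ∏≡k (∏powers-∣ id fs ps u λ {q} {a} q∈ →
                ∣-sum-of-multiple {{prime⇒nonZero (All.lookup ps q∈)}} a n (q^a+1∣P q∈))

periodOf-least : ∀ k .{{_ : NonZero k}} fs → IsFactorisation k fs → ∀ L → IsPeriod k L → periodOf fs ≤ L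
periodOf-least k fs (ps , u , as , ∏≡k) L per =
  ∣⇒≤ {{>-nonZero (proj₁ per)}} (∏powers-∣ suc fs ps u q^a+1∣L)
  where
    open Criterion k
    k∣L : k ∣ L
    k∣L = proj₁ (period⇒conditions per)
    k∣S : ∀ n → 1 ≤ n → k ∣ S n L
    k∣S = proj₂ (period⇒conditions per)
    q^a∣k : ∀ {q a} → (q , a) ∈ fs → q ^ a ∣ k
    q^a∣k q∈ = subst (_ ∣_) ∏≡k (∈⇒power∣∏ id q∈)
    q∣q^a : ∀ {q a} → 1 ≤ a → q ∣ q ^ a
    q∣q^a (s≤s z≤n) = m∣m*n _
    q^a+1∣L : ∀ {q a} → (q , a) ∈ fs → q ^ suc a ∣ L
    q^a+1∣L {a = a} q∈ = prime-power-bound a (All.lookup ps q∈)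
                   (∣-trans (q∣q^a (All.lookup as q∈)) (∣-trans (q^a∣k q∈) k∣L))
                   (λ n n≥1 → ∣-trans (q^a∣k q∈) (k∣S n n≥1))

theorem8 : (k : ℕ) → .{{_ : NonZero k}} →
    Σ ℕ (λ L → IsPeriod k L) ×
    ((fs : List (ℕ × ℕ)) → IsFactorisation k fs → IsLeastPeriod k (periodOf fs))
theorem8 k = (k ^ 2 , square-isPeriod k) , λ fs fact →
  periodOf-isPeriod k fs fact , periodOf-least k fs fact
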